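{- Let $\mathcal{G}$ be a finite partial Sherk plane. Then no line of $\mathcal{G}$ is perpendicular to itself.
   Context: A partial Sherk plane is a structure of points, lines, an incidence relation, and a binary relation $\perp$ on lines satisfying: (A*) two distinct points lie on at most one line; (B1) $\ell\perp m$ implies $m\perp\ell$; (B2) perpendicular lines intersect in at least one point; (B3) for any point $P$ and line $\ell$ there is at least one line through $P$ perpendicular to $\ell$; (B4) for any line $\ell$ and point $P$ on $\ell$ there is a unique line through $P$ perpendicular to $\ell$; (B5) there exist lines $x,y,z$ with $x\perp y$, $x\not\perp z$, $y\not\perp z$, and $x,y,z$ not all through a common point. Finite means finitely many points. -}

module Defs where

open import Level using (Level; _⊔_; suc)
open import Data.Nat using (ℕ)
open import Data.Fin using (Fin)
open import Data.Product using (Σ; ∃; _×_)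
open import Relation.Nullary using (¬_)
open import Relation.Binary.PropositionalEquality using (_≡_)
open import Function.Bundles using (_↔_)

record PartialSherkPlane (p l : Level) : Set (suc (p ⊔ l)) where
  field
    Point : Set p
    Line  : Set l
    _I_   : Point → Line → Set (p ⊔ l)
    _⊥_   : Line → Line → Set l
    axA   : ∀ {P Q : Point} {ℓ m : Line} → ¬ (P ≡ Q) →
            P I ℓ → Q I ℓ → P I m → Q I m → ℓ ≡ m
    axB1  : ∀ {ℓ m : Line} → ℓ ⊥ m → m ⊥ ℓ
    axB2  : ∀ {ℓ m : Line} → ℓ ⊥ m → ∃ λ (P : Point) → P I ℓ × P I m
    axB3  : ∀ (P : Point) (ℓ : Line) → ∃ λ (m : Line) → P I m × m ⊥ ℓ
    axB4  : ∀ {P : Point} {ℓ m m′ : Line} → P I ℓ →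
            P I m → m ⊥ ℓ → P I m′ → m′ ⊥ ℓ → m ≡ m′
    axB5  : Σ Line λ x → Σ Line λ y → Σ Line λ z →
            (x ⊥ y) × ¬ (x ⊥ z) × ¬ (y ⊥ z) ×
            ¬ (∃ λ (P : Point) → P I x × P I y × P I z)

IsFinite : ∀ {p l} → PartialSherkPlane p l → Set p
IsFinite G = ∃ λ (n : ℕ) → PartialSherkPlane.Point G ↔ Fin n

module Submission where

-- A line perpendicular to itself swallows the whole plane.  Suppose ℓ ⟂ ℓ.
-- By (B4) ℓ is the only perpendicular to ℓ at each of its points, and (B2)
-- makes every perpendicular to ℓ pass through such a point, so ℓ is the only
-- line perpendicular to ℓ.  With (B3) this puts every point on ℓ, and then
-- (A*) makes every line through two distinct points equal to ℓ.  A line k ≠ ℓ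
-- must therefore contain every point P: otherwise the perpendicular to k
-- through P would be a secant through P, hence ℓ, and k ⟂ ℓ would force
-- k = ℓ.  Since (B5) provides two distinct points, every line is ℓ (up to
-- double negation, which suffices because the goal is ⊥; no decidable
-- equality of points is needed).  But (B5) also gives x ⟂ y with x not
-- perpendicular to z, impossible once y = z = ℓ.

open import Defs
open import Level using (Level)
open import Relation.Nullary using (¬_)
open import Data.Product using (Σ; _,_)
open import Relation.Binary.PropositionalEquality using (_≡_; refl; subst; sym; trans)

module _ {p l : Level} (G : PartialSherkPlane p l) where
  open PartialSherkPlane G renaming (_⊥_ to _⟂_)

  -- Every partial Sherk plane has two distinct points: x and y of (B5) meet in
  -- P, and any point on z differs from P because x, y, z are not concurrent.
  two-distinct-points : Σ Point λ P → Σ Point λ Q → ¬ (P ≡ Q)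
  two-distinct-points with axB5
  ... | x , y , z , x⟂y , _ , _ , not-concurrent with axB2 x⟂y
  ... | P , Px , Py with axB3 P z
  ... | m , _ , m⟂z with axB2 m⟂z
  ... | Q , _ , Qz = P , Q , P≢Q
    where
    P≢Q : ¬ (P ≡ Q)
    P≢Q refl = not-concurrent (P , Px , Py , Qz)

  module SelfPerpendicular {ℓ : Line} (ℓ⟂ℓ : ℓ ⟂ ℓ) where

    perpendicular-is-ℓ : ∀ {k} → k ⟂ ℓ → k ≡ ℓ
    perpendicular-is-ℓ k⟂ℓ with axB2 k⟂ℓ
    ... | R , Rk , Rℓ = axB4 Rℓ Rk k⟂ℓ Rℓ ℓ⟂ℓ

    every-point-on-ℓ : ∀ Q → Q I ℓ
    every-point-on-ℓ Q with axB3 Q ℓ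
    ... | m , Qm , m⟂ℓ = subst (Q I_) (perpendicular-is-ℓ m⟂ℓ) Qm

    secant-is-ℓ : ∀ {P Q k} → ¬ (P ≡ Q) → P I k → Q I k → k ≡ ℓ
    secant-is-ℓ P≢Q Pk Qk =
      axA P≢Q Pk Qk (every-point-on-ℓ _) (every-point-on-ℓ _)

    -- A line other than ℓ passes through every point P: the perpendicular m
    -- to k through P meets k in R; were P off k, then R ≠ P, so m = ℓ is a
    -- secant, and k ⟂ ℓ would give k = ℓ.
    other-line-through-every-point : ∀ {k} → ¬ (k ≡ ℓ) → ∀ P → ¬ ¬ (P I k)
    other-line-through-every-point {k} k≢ℓ P P∉k with axB3 P k
    ... | m , Pm , m⟂k with axB2 m⟂k
    ... | R , Rm , Rk = k≢ℓ (perpendicular-is-ℓ (axB1 ℓ⟂k))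
      where
      R≢P : ¬ (R ≡ P)
      R≢P refl = P∉k Rk
      ℓ⟂k : ℓ ⟂ k
      ℓ⟂k = subst (_⟂ k) (secant-is-ℓ R≢P Rm Pm) m⟂k

    every-line-is-ℓ : ∀ {P Q} → ¬ (P ≡ Q) → ∀ k → ¬ ¬ (k ≡ ℓ)
    every-line-is-ℓ {P} {Q} P≢Q k k≢ℓ =
      other-line-through-every-point k≢ℓ P λ Pk →
      other-line-through-every-point k≢ℓ Q λ Qk →
      k≢ℓ (secant-is-ℓ P≢Q Pk Qk)

  no-self-perpendicular : ∀ (ℓ : Line) → ¬ (ℓ ⟂ ℓ)
  no-self-perpendicular ℓ ℓ⟂ℓ with axB5 | two-distinct-points
  ... | x , y , z , x⟂y , x⟂̸z , _ , _ | P , Q , P≢Q =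
    every-line-is-ℓ P≢Q y λ y≡ℓ →
    every-line-is-ℓ P≢Q z λ z≡ℓ →
    x⟂̸z (subst (x ⟂_) (trans y≡ℓ (sym z≡ℓ)) x⟂y)
    where open SelfPerpendicular ℓ⟂ℓ

-- Lemma 3.2: in a finite partial Sherk plane no line is perpendicular to
-- itself.
lemma3p2 : ∀ {p l : Level} (G : PartialSherkPlane p l) → IsFinite G →
    ∀ (ℓ : PartialSherkPlane.Line G) → ¬ (PartialSherkPlane._⊥_ G ℓ ℓ)
lemma3p2 G _ = no-self-perpendicular G
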